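{- Let $D$ be a digraph of order $n$, and let $G_D$ be the simple graph constructed from $D$ as follows. First build a digraph $G'_D$: for each vertex $v$ of $D$ take two vertices $v$ and $v'$ together with the arc $(v,v')$, and for each arc $(v_i,v_j)$ of $D$ add the two arcs $(v_i,v_j)$ and $(v_i,v_j')$. Then $G_D$ is the underlying (undirected) graph of $G'_D$. Then (i) $\gamma(G_D)=\gamma(D)$, and (ii) $\rho(G_D)=\rho(D)$.
   Context: Digraphs are finite, without loops or multiple arcs (pairs of opposite arcs $(u,v),(v,u)$ are allowed). For a vertex $v$ of a digraph $D$, $N^+[v]=\{v\}\cup\{u:(v,u)\in A(D)\}$. A set $S\subseteq V(D)$ is a dominating set of $D$ if every vertex of $V(D)\setminus S$ has an in-neighbor in $S$; $\gamma(D)$ is the minimum size of a dominating set of $D$. A set $B\subseteq V(D)$ is a packing in $D$ if $|N^+[v]\cap B|\le 1$ for every $v\in V(D)$; $\rho(D)$ is the maximum size of a packing in $D$. For a simple graph $G$, $\gamma(G)$ is its usual domination number and $\rho(G)$ is the maximum size of a set $B\subseteq V(G)$ such that the closed neighborhoods $N[u],N[v]$ are disjoint for all distinct $u,v\in B$. -}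

module Defs where

open import Data.Nat using (ℕ; _+_; _≤_)
open import Data.Bool using (Bool; true; false; _∨_)
open import Data.Fin using (Fin; splitAt)
open import Data.Fin.Subset using (Subset; _∈_; _∉_; ∣_∣)
open import Data.Sum using (_⊎_; inj₁; inj₂)
open import Data.Product using (Σ; _×_; ∃; _,_)
open import Relation.Binary.PropositionalEquality using (_≡_; _≢_)
open import Relation.Nullary using (¬_)

-- A (finite) digraph on vertex set Fin n: arcs given by a Boolean arc relation,
-- without loops. Opposite arcs (u,v),(v,u) are allowed; no multiple arcs by construction.
record Digraph (n : ℕ) : Set where
  field
    arc      : Fin n → Fin n → Bool
    loopless : ∀ v → arc v v ≡ false
open Digraph public

record Graph (m : ℕ) : Set where
  field
    adj     : Fin m → Fin m → Bool
    sym     : ∀ u v → adj u v ≡ adj v u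
    irrefl  : ∀ v → adj v v ≡ false
open Graph public

InOutClosed : ∀ {n} → Digraph n → Fin n → Fin n → Set
InOutClosed D v u = (u ≡ v) ⊎ (arc D v u ≡ true)

DominatingD : ∀ {n} → Digraph n → Subset n → Set
DominatingD {n} D S = ∀ v → v ∉ S → Σ (Fin n) λ u → (u ∈ S) × (arc D u v ≡ true)

IsDomNumD : ∀ {n} → Digraph n → ℕ → Set
IsDomNumD {n} D k =
  (Σ (Subset n) λ S → DominatingD D S × (∣ S ∣ ≡ k)) ×
  (∀ (S : Subset n) → DominatingD D S → k ≤ ∣ S ∣)

PackingD : ∀ {n} → Digraph n → Subset n → Set
PackingD D B = ∀ v u w → InOutClosed D v u → InOutClosed D v w →
               u ∈ B → w ∈ B → u ≡ w

IsPackNumD : ∀ {n} → Digraph n → ℕ → Set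
IsPackNumD {n} D k =
  (Σ (Subset n) λ B → PackingD D B × (∣ B ∣ ≡ k)) ×
  (∀ (B : Subset n) → PackingD D B → ∣ B ∣ ≤ k)

InClosedNbhd : ∀ {m} → Graph m → Fin m → Fin m → Set
InClosedNbhd G v u = (u ≡ v) ⊎ (adj G v u ≡ true)

DominatingG : ∀ {m} → Graph m → Subset m → Set
DominatingG {m} G S = ∀ v → v ∉ S → Σ (Fin m) λ u → (u ∈ S) × (adj G u v ≡ true)

IsDomNumG : ∀ {m} → Graph m → ℕ → Set
IsDomNumG {m} G k =
  (Σ (Subset m) λ S → DominatingG G S × (∣ S ∣ ≡ k)) ×
  (∀ (S : Subset m) → DominatingG G S → k ≤ ∣ S ∣)

PackingG : ∀ {m} → Graph m → Subset m → Set
PackingG {m} G B = ∀ u w → u ∈ B → w ∈ B → u ≢ w →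
                   ¬ (Σ (Fin m) λ x → InClosedNbhd G u x × InClosedNbhd G w x)

IsPackNumG : ∀ {m} → Graph m → ℕ → Set
IsPackNumG {m} G k =
  (Σ (Subset m) λ B → PackingG G B × (∣ B ∣ ≡ k)) ×
  (∀ (B : Subset m) → PackingG G B → ∣ B ∣ ≤ k)

-- The construction G_D.  Vertex set Fin (n + n): the first block (inj₁ v)
-- is the copy v, the second block (inj₂ v) is v'.

arcG' : ∀ {n} → Digraph n → Fin n ⊎ Fin n → Fin n ⊎ Fin n → Bool
arcG' D (inj₁ v) (inj₁ u) = arc D v u
arcG' D (inj₁ v) (inj₂ u) = arc D v u ∨ diag v u
  where
  open import Data.Fin using (_≟_)
  open import Relation.Nullary using (does)
  diag : _ → _ → Bool
  diag a b = does (a ≟ b)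
arcG' D (inj₂ v) _        = false

adjGD : ∀ {n} → Digraph n → Fin (n + n) → Fin (n + n) → Bool
adjGD {n} D x y = arcG' D (splitAt n x) (splitAt n y) ∨ arcG' D (splitAt n y) (splitAt n x)

private
  open import Data.Bool.Properties using (∨-comm)
  open import Relation.Binary.PropositionalEquality using (refl; cong₂)

  arcG'-irrefl : ∀ {n} (D : Digraph n) x → arcG' D x x ≡ false
  arcG'-irrefl D (inj₁ v) = loopless D v
  arcG'-irrefl D (inj₂ v) = refl

  adjGD-irrefl : ∀ {n} (D : Digraph n) x → adjGD D x x ≡ false
  adjGD-irrefl {n} D x with arcG' D (splitAt n x) (splitAt n x) | arcG'-irrefl D (splitAt n x)
  ... | false | refl = refl

G[_] : ∀ {n} → Digraph n → Graph (n + n)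
G[ D ] = record
  { adj    = adjGD D
  ; sym    = λ x y → ∨-comm (arcG' D (splitAt _ x) (splitAt _ y)) (arcG' D (splitAt _ y) (splitAt _ x))
  ; irrefl = adjGD-irrefl D
  }

-- The primed copies are pairwise
-- non-adjacent, and v′ is adjacent exactly to the unprimed u with v ∈ N⁺[u]; so the
-- unprimed copy of u dominates both copies of every vertex of N⁺[u].  Hence a dominating
-- set of D, placed on the unprimed copies, dominates G_D, and a packing of D, placed on
-- the primed copies, is a packing of G_D.  Conversely, the projection v, v′ ↦ v sends a
-- dominating set of G_D to a dominating set of D that is no larger, and a packing of G_D
-- injectively to a packing of D: a packing never contains both v and v′, as they share
-- the neighbour v.
module Submission where

open import Defs hiding (sym)
open import Level using (Level)
open import Data.Nat using (ℕ; suc; _+_; _≤_; z≤n; s≤s)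
open import Data.Nat.Properties
  using (≤-trans; ≤-antisym; ≤-reflexive; n≤1+n; +-suc; +-identityʳ; +-monoʳ-≤)
open import Data.Bool using (true; false; _∨_)
open import Data.Bool.Properties using (∨-zeroʳ; ∨-identityʳ)
open import Data.Fin as Fin using (Fin; splitAt; join; _↑ˡ_; _↑ʳ_; _≟_)
open import Data.Fin.Properties using (splitAt-↑ˡ; splitAt-↑ʳ; splitAt-join; ↑ˡ-injective; ↑ʳ-injective; join-splitAt)
open import Data.Fin.Subset using (Subset; inside; outside; _∈_; _∉_; ∣_∣; _∪_; ⊥)
open import Data.Fin.Subset.Properties using (_∈?_; ∉⊥; ∣⊥∣≡0; x∈p∪q⁺; x∈p∪q⁻)
open import Data.Vec as Vec using (Vec; []; _∷_; _++_; _[_]=_; here; there)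
open import Data.Sum using (_⊎_; inj₁; inj₂)
open import Data.Product using (Σ; _×_; ∃; _,_)
open import Data.Empty using (⊥-elim)
open import Function.Bundles using (_⇔_; mk⇔)
open import Relation.Nullary using (yes; no; does)
open import Relation.Nullary.Decidable using (dec-true)
open import Relation.Binary.PropositionalEquality using (_≡_; _≢_; refl; sym; trans; cong; subst)

private
  variable
    ℓ : Level
    m k : ℕ
    A : Set ℓ

IsMinSize : (Subset m → Set) → ℕ → Set
IsMinSize {m} P k = (Σ (Subset m) λ S → P S × (∣ S ∣ ≡ k)) × (∀ S → P S → k ≤ ∣ S ∣)

IsMaxSize : (Subset m → Set) → ℕ → Set
IsMaxSize {m} P k = (Σ (Subset m) λ S → P S × (∣ S ∣ ≡ k)) × (∀ S → P S → ∣ S ∣ ≤ k)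

ShrinksInto : (Subset m → Set) → (Subset k → Set) → Set
ShrinksInto {k = k} P Q = ∀ S → P S → Σ (Subset k) λ S′ → Q S′ × (∣ S′ ∣ ≤ ∣ S ∣)

GrowsInto : (Subset m → Set) → (Subset k → Set) → Set
GrowsInto {k = k} P Q = ∀ S → P S → Σ (Subset k) λ S′ → Q S′ × (∣ S ∣ ≤ ∣ S′ ∣)

module _ {P : Subset m → Set} {Q : Subset k → Set} where

  isMinSize-transfer : ShrinksInto P Q → ShrinksInto Q P →
                       ∀ {s} → IsMinSize P s → IsMinSize Q s
  isMinSize-transfer P→Q Q→P ((S , pS , ∣S∣≡s) , s≤) with P→Q S pS
  ... | S′ , qS′ , ∣S′∣≤∣S∣ =
    (S′ , qS′ , ≤-antisym (≤-trans ∣S′∣≤∣S∣ (≤-reflexive ∣S∣≡s)) (lower S′ qS′)) , lower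
    where
    lower : ∀ T → Q T → _ ≤ ∣ T ∣
    lower T qT with Q→P T qT
    ... | T′ , pT′ , ∣T′∣≤∣T∣ = ≤-trans (s≤ T′ pT′) ∣T′∣≤∣T∣

  isMaxSize-transfer : GrowsInto P Q → GrowsInto Q P →
                       ∀ {s} → IsMaxSize P s → IsMaxSize Q s
  isMaxSize-transfer P→Q Q→P ((S , pS , ∣S∣≡s) , ≤s) with P→Q S pS
  ... | S′ , qS′ , ∣S∣≤∣S′∣ =
    (S′ , qS′ , ≤-antisym (upper S′ qS′) (≤-trans (≤-reflexive (sym ∣S∣≡s)) ∣S∣≤∣S′∣)) , upper
    where
    upper : ∀ T → Q T → ∣ T ∣ ≤ _
    upper T qT with Q→P T qT
    ... | T′ , pT′ , ∣T∣≤∣T′∣ = ≤-trans ∣T∣≤∣T′∣ (≤s T′ pT′)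

isMinSize-⇔ : {P : Subset m → Set} {Q : Subset k → Set} →
              ShrinksInto P Q → ShrinksInto Q P → ∀ s → IsMinSize P s ⇔ IsMinSize Q s
isMinSize-⇔ P→Q Q→P s = mk⇔ (isMinSize-transfer P→Q Q→P) (isMinSize-transfer Q→P P→Q)

isMaxSize-⇔ : {P : Subset m → Set} {Q : Subset k → Set} →
              GrowsInto P Q → GrowsInto Q P → ∀ s → IsMaxSize P s ⇔ IsMaxSize Q s
isMaxSize-⇔ P→Q Q→P s = mk⇔ (isMaxSize-transfer P→Q Q→P) (isMaxSize-transfer Q→P P→Q)

[]=-++⁺ˡ : ∀ {xs : Vec A m} (ys : Vec A k) {i x} → xs [ i ]= x → xs ++ ys [ i ↑ˡ k ]= x
[]=-++⁺ˡ ys here        = here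
[]=-++⁺ˡ ys (there xsᵢ) = there ([]=-++⁺ˡ ys xsᵢ)

[]=-++⁻ˡ : ∀ (xs : Vec A m) (ys : Vec A k) {i x} → xs ++ ys [ i ↑ˡ k ]= x → xs [ i ]= x
[]=-++⁻ˡ (_ ∷ xs) ys {Fin.zero}  here      = here
[]=-++⁻ˡ (_ ∷ xs) ys {Fin.suc i} (there p) = there ([]=-++⁻ˡ xs ys p)

[]=-++⁺ʳ : ∀ (xs : Vec A m) {ys : Vec A k} {i x} → ys [ i ]= x → xs ++ ys [ m ↑ʳ i ]= x
[]=-++⁺ʳ []       ysᵢ = ysᵢ
[]=-++⁺ʳ (_ ∷ xs) ysᵢ = there ([]=-++⁺ʳ xs ysᵢ)

[]=-++⁻ʳ : ∀ (xs : Vec A m) {ys : Vec A k} {i x} → xs ++ ys [ m ↑ʳ i ]= x → ys [ i ]= x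
[]=-++⁻ʳ []       p         = p
[]=-++⁻ʳ (_ ∷ xs) (there p) = []=-++⁻ʳ xs p

∣p++q∣≡∣p∣+∣q∣ : ∀ (p : Subset m) (q : Subset k) → ∣ p ++ q ∣ ≡ ∣ p ∣ + ∣ q ∣
∣p++q∣≡∣p∣+∣q∣ []            q = refl
∣p++q∣≡∣p∣+∣q∣ (inside  ∷ p) q = cong suc (∣p++q∣≡∣p∣+∣q∣ p q)
∣p++q∣≡∣p∣+∣q∣ (outside ∷ p) q = ∣p++q∣≡∣p∣+∣q∣ p q

∣p∪q∣≤∣p∣+∣q∣ : ∀ (p q : Subset m) → ∣ p ∪ q ∣ ≤ ∣ p ∣ + ∣ q ∣
∣p∪q∣≤∣p∣+∣q∣ []            []            = z≤n
∣p∪q∣≤∣p∣+∣q∣ (inside  ∷ p) (inside  ∷ q) = s≤s (≤-trans (∣p∪q∣≤∣p∣+∣q∣ p q) (+-monoʳ-≤ ∣ p ∣ (n≤1+n _)))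
∣p∪q∣≤∣p∣+∣q∣ (inside  ∷ p) (outside ∷ q) = s≤s (∣p∪q∣≤∣p∣+∣q∣ p q)
∣p∪q∣≤∣p∣+∣q∣ (outside ∷ p) (inside  ∷ q) = ≤-trans (s≤s (∣p∪q∣≤∣p∣+∣q∣ p q)) (≤-reflexive (sym (+-suc ∣ p ∣ ∣ q ∣)))
∣p∪q∣≤∣p∣+∣q∣ (outside ∷ p) (outside ∷ q) = ∣p∪q∣≤∣p∣+∣q∣ p q

∣p∣+∣q∣≤∣p∪q∣ : ∀ (p q : Subset m) → (∀ {x} → x ∈ p → x ∉ q) → ∣ p ∣ + ∣ q ∣ ≤ ∣ p ∪ q ∣
∣p∣+∣q∣≤∣p∪q∣ []            []            _        = z≤n
∣p∣+∣q∣≤∣p∪q∣ (inside  ∷ p) (inside  ∷ q) disjoint = ⊥-elim (disjoint here here)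
∣p∣+∣q∣≤∣p∪q∣ (inside  ∷ p) (outside ∷ q) disjoint =
  s≤s (∣p∣+∣q∣≤∣p∪q∣ p q λ x∈p x∈q → disjoint (there x∈p) (there x∈q))
∣p∣+∣q∣≤∣p∪q∣ (outside ∷ p) (inside  ∷ q) disjoint =
  ≤-trans (≤-reflexive (+-suc ∣ p ∣ ∣ q ∣)) (s≤s (∣p∣+∣q∣≤∣p∪q∣ p q λ x∈p x∈q → disjoint (there x∈p) (there x∈q)))
∣p∣+∣q∣≤∣p∪q∣ (outside ∷ p) (outside ∷ q) disjoint =
  ∣p∣+∣q∣≤∣p∪q∣ p q λ x∈p x∈q → disjoint (there x∈p) (there x∈q)

∨≡true⁻ : ∀ b c → b ∨ c ≡ true → b ≡ true ⊎ c ≡ true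
∨≡true⁻ true  c _    = inj₁ refl
∨≡true⁻ false c c≡tt = inj₂ c≡tt

module _ {n : ℕ} where

  data Copy (v : Fin n) : Fin (n + n) → Set where
    unprimed : Copy v (v ↑ˡ n)
    primed   : Copy v (n ↑ʳ v)

  copy : ∀ x → ∃ λ v → Copy v x
  copy x = subst (λ y → ∃ λ v → Copy v y) (join-splitAt n n x) (copyOfJoin (splitAt n x))
    where
    copyOfJoin : ∀ s → ∃ λ v → Copy v (join n n s)
    copyOfJoin (inj₁ v) = v , unprimed
    copyOfJoin (inj₂ v) = v , primed

  unprimed≢primed : ∀ {u v : Fin n} → u ↑ˡ n ≢ n ↑ʳ v
  unprimed≢primed {u} {v} eq
    with trans (sym (splitAt-↑ˡ n u n)) (trans (cong (splitAt n) eq) (splitAt-↑ʳ n n v))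
  ... | ()

  copy-injective : ∀ {u v x y} → Copy u x → Copy v y → x ≡ y → u ≡ v
  copy-injective {u} {v} unprimed unprimed eq = ↑ˡ-injective n u v eq
  copy-injective         unprimed primed   eq = ⊥-elim (unprimed≢primed eq)
  copy-injective         primed   unprimed eq = ⊥-elim (unprimed≢primed (sym eq))
  copy-injective {u} {v} primed   primed   eq = ↑ʳ-injective n u v eq

  copy-∈-++ : ∀ {u} (A B : Subset n) → u ∈ A ∪ B → Σ (Fin (n + n)) λ x → Copy u x × x ∈ A ++ B
  copy-∈-++ {u} A B u∈A∪B with x∈p∪q⁻ A B u∈A∪B
  ... | inj₁ u∈A = u ↑ˡ n , unprimed , []=-++⁺ˡ B u∈A
  ... | inj₂ u∈B = n ↑ʳ u , primed   , []=-++⁺ʳ A u∈B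

module _ {n : ℕ} (D : Digraph n) where

  adjGD-join : ∀ s t → adjGD D (join n n s) (join n n t) ≡ arcG' D s t ∨ arcG' D t s
  adjGD-join s t rewrite splitAt-join n n s | splitAt-join n n t = refl

  adjGD-unprimed-unprimed : ∀ {u v} → arc D u v ≡ true → adjGD D (u ↑ˡ n) (v ↑ˡ n) ≡ true
  adjGD-unprimed-unprimed {u} {v} uv = trans (adjGD-join (inj₁ u) (inj₁ v)) (cong (_∨ arc D v u) uv)

  adjGD-primed-primed : ∀ u v → adjGD D (n ↑ʳ u) (n ↑ʳ v) ≢ true
  adjGD-primed-primed u v adj with () ← trans (sym (adjGD-join (inj₂ u) (inj₂ v))) adj

  adjGD-unprimed-primed⁺ : ∀ {u v} → InOutClosed D u v → adjGD D (u ↑ˡ n) (n ↑ʳ v) ≡ true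
  adjGD-unprimed-primed⁺ {u} {v} v∈N⁺[u] =
    trans (adjGD-join (inj₁ u) (inj₂ v)) (cong (_∨ false) (arc-or-equal v∈N⁺[u]))
    where
    arc-or-equal : InOutClosed D u v → arc D u v ∨ does (u ≟ v) ≡ true
    arc-or-equal (inj₁ refl) = trans (cong (arc D u u ∨_) (dec-true (u ≟ u) refl)) (∨-zeroʳ _)
    arc-or-equal (inj₂ uv)   = cong (_∨ does (u ≟ v)) uv

  adjGD-unprimed-primed⁻ : ∀ {u v} → adjGD D (u ↑ˡ n) (n ↑ʳ v) ≡ true → InOutClosed D u v
  adjGD-unprimed-primed⁻ {u} {v} adj
    with ∨≡true⁻ (arc D u v) (does (u ≟ v))
           (trans (sym (∨-identityʳ _)) (trans (sym (adjGD-join (inj₁ u) (inj₂ v))) adj))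
  ... | inj₁ uv = inj₂ uv
  ... | inj₂ u≟v with u ≟ v | u≟v
  ...   | yes refl | _  = inj₁ refl
  ...   | no _     | ()

  adjGD-unprimed-copy : ∀ {u v x} → arc D u v ≡ true → Copy v x → adjGD D (u ↑ˡ n) x ≡ true
  adjGD-unprimed-copy uv unprimed = adjGD-unprimed-unprimed uv
  adjGD-unprimed-copy uv primed   = adjGD-unprimed-primed⁺ (inj₂ uv)

  adjGD-sym : ∀ {x y} → adjGD D x y ≡ true → adjGD D y x ≡ true
  adjGD-sym {x} {y} adj = trans (Graph.sym G[ D ] y x) adj

  copy-∈-nbhd : ∀ {u v x} → Copy u x → InOutClosed D v u → InClosedNbhd G[ D ] x (v ↑ˡ n)
  copy-∈-nbhd unprimed (inj₁ refl) = inj₁ refl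
  copy-∈-nbhd unprimed (inj₂ vu)   = inj₂ (adjGD-sym (adjGD-unprimed-unprimed vu))
  copy-∈-nbhd primed   u∈N⁺[v]     = inj₂ (adjGD-sym (adjGD-unprimed-primed⁺ u∈N⁺[v]))

  closedNbhd-primed : ∀ {u : Fin n} {z} → InClosedNbhd G[ D ] (n ↑ʳ u) z →
                z ≡ n ↑ʳ u ⊎ Σ (Fin n) λ w → z ≡ w ↑ˡ n × InOutClosed D w u
  closedNbhd-primed (inj₁ z≡u′) = inj₁ z≡u′
  closedNbhd-primed {u} {z} (inj₂ adj) with copy {n} z
  ... | w , unprimed = inj₂ (w , refl , adjGD-unprimed-primed⁻ (adjGD-sym adj))
  ... | w , primed   = ⊥-elim (adjGD-primed-primed u w adj)

  dominatingD⇒dominatingG : ∀ S → DominatingD D S → DominatingG G[ D ] (S ++ ⊥)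
  dominatingD⇒dominatingG S dom x x∉ with copy {n} x
  ... | v , cv with v ∈? S | cv
  ...   | yes v∈S | unprimed = ⊥-elim (x∉ ([]=-++⁺ˡ ⊥ v∈S))
  ...   | yes v∈S | primed   = v ↑ˡ n , []=-++⁺ˡ ⊥ v∈S , adjGD-unprimed-primed⁺ (inj₁ refl)
  ...   | no v∉S  | _ with dom v v∉S
  ...     | u , u∈S , uv = u ↑ˡ n , []=-++⁺ˡ ⊥ u∈S , adjGD-unprimed-copy uv cv

  dominatingG⇒dominatingD : ∀ A B → DominatingG G[ D ] (A ++ B) → DominatingD D (A ∪ B)
  dominatingG⇒dominatingD A B dom w w∉
    with dom (n ↑ʳ w) (λ w′∈ → w∉ (x∈p∪q⁺ (inj₂ ([]=-++⁻ʳ A w′∈))))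
  ... | y , y∈ , adj with copy {n} y
  ...   | u , primed   = ⊥-elim (adjGD-primed-primed u w adj)
  ...   | u , unprimed with adjGD-unprimed-primed⁻ adj
  ...     | inj₁ refl = ⊥-elim (w∉ (x∈p∪q⁺ (inj₁ ([]=-++⁻ˡ A B y∈))))
  ...     | inj₂ uw   = u , x∈p∪q⁺ (inj₁ ([]=-++⁻ˡ A B y∈)) , uw

  packingD⇒packingG : ∀ B → PackingD D B → PackingG G[ D ] (⊥ ++ B)
  packingD⇒packingG B pack x y x∈ y∈ x≢y (z , z∈N[x] , z∈N[y]) with copy {n} x | copy {n} y
  ... | u , unprimed | _ = ∉⊥ ([]=-++⁻ˡ ⊥ B x∈)
  ... | _ | v , unprimed = ∉⊥ ([]=-++⁻ˡ ⊥ B y∈)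
  ... | u , primed | v , primed with closedNbhd-primed z∈N[x] | closedNbhd-primed z∈N[y]
  ...   | inj₁ z≡u′ | inj₁ z≡v′ = x≢y (trans (sym z≡u′) z≡v′)
  ...   | inj₁ z≡u′ | inj₂ (w , z≡w , _) = unprimed≢primed (trans (sym z≡w) z≡u′)
  ...   | inj₂ (w , z≡w , _) | inj₁ z≡v′ = unprimed≢primed (trans (sym z≡w) z≡v′)
  ...   | inj₂ (w , z≡w , u∈N⁺[w]) | inj₂ (w′ , z≡w′ , v∈N⁺[w′])
    with ↑ˡ-injective n w w′ (trans (sym z≡w) z≡w′)
  ...     | refl = x≢y (cong (n ↑ʳ_) (pack w u v u∈N⁺[w] v∈N⁺[w′] ([]=-++⁻ʳ ⊥ x∈) ([]=-++⁻ʳ ⊥ y∈)))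

  packingG-disjoint : ∀ A B → PackingG G[ D ] (A ++ B) → ∀ {u} → u ∈ A → u ∉ B
  packingG-disjoint A B pack {u} u∈A u∈B =
    pack (u ↑ˡ n) (n ↑ʳ u) ([]=-++⁺ˡ B u∈A) ([]=-++⁺ʳ A u∈B) unprimed≢primed
         (u ↑ˡ n , inj₁ refl , copy-∈-nbhd primed (inj₁ refl))

  packingG⇒packingD : ∀ A B → PackingG G[ D ] (A ++ B) → PackingD D (A ∪ B)
  packingG⇒packingD A B pack v u w u∈N⁺[v] w∈N⁺[v] u∈ w∈ with u ≟ w
  ... | yes u≡w = u≡w
  ... | no  u≢w with copy-∈-++ A B u∈ | copy-∈-++ A B w∈
  ...   | x , cu , x∈ | y , cw , y∈ =
    ⊥-elim (pack x y x∈ y∈ (λ x≡y → u≢w (copy-injective cu cw x≡y))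
                 (v ↑ˡ n , copy-∈-nbhd cu u∈N⁺[v] , copy-∈-nbhd cw w∈N⁺[v]))

  dominatingG-shrinksInto-D : ShrinksInto (DominatingG G[ D ]) (DominatingD D)
  dominatingG-shrinksInto-D S dom with Vec.splitAt n S
  ... | A , B , refl =
    A ∪ B , dominatingG⇒dominatingD A B dom ,
    ≤-trans (∣p∪q∣≤∣p∣+∣q∣ A B) (≤-reflexive (sym (∣p++q∣≡∣p∣+∣q∣ A B)))

  dominatingD-shrinksInto-G : ShrinksInto (DominatingD D) (DominatingG G[ D ])
  dominatingD-shrinksInto-G S dom =
    S ++ ⊥ , dominatingD⇒dominatingG S dom ,
    ≤-reflexive (trans (∣p++q∣≡∣p∣+∣q∣ S ⊥) (trans (cong (∣ S ∣ +_) (∣⊥∣≡0 n)) (+-identityʳ ∣ S ∣)))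

  packingG-growsInto-D : GrowsInto (PackingG G[ D ]) (PackingD D)
  packingG-growsInto-D S pack with Vec.splitAt n S
  ... | A , B , refl =
    A ∪ B , packingG⇒packingD A B pack ,
    ≤-trans (≤-reflexive (∣p++q∣≡∣p∣+∣q∣ A B)) (∣p∣+∣q∣≤∣p∪q∣ A B (packingG-disjoint A B pack))

  packingD-growsInto-G : GrowsInto (PackingD D) (PackingG G[ D ])
  packingD-growsInto-G B pack =
    ⊥ ++ B , packingD⇒packingG B pack ,
    ≤-reflexive (sym (trans (∣p++q∣≡∣p∣+∣q∣ (⊥ {n = n}) B) (cong (_+ ∣ B ∣) (∣⊥∣≡0 n))))

lemma2 : ∀ {n} (D : Digraph n) →
           (∀ k → IsDomNumG G[ D ] k ⇔ IsDomNumD D k) ×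
           (∀ k → IsPackNumG G[ D ] k ⇔ IsPackNumD D k)
lemma2 D =
  isMinSize-⇔ (dominatingG-shrinksInto-D D) (dominatingD-shrinksInto-G D) ,
  isMaxSize-⇔ (packingG-growsInto-D D) (packingD-growsInto-G D)
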